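{- Let $k$ be a positive integer and let $G$ be a connected graph with $n$ vertices and $\mathrm{ola}^+(G)\le k$. Then either $G$ has a $k$-separating bridge or $n\le 4k+1$.
   Context: Graphs are finite, without loops or parallel edges. A linear arrangement of $G=(V,E)$ is a bijection $\alpha:V\to\{1,\dots,|V|\}$; net cost $\sum_{uv\in E}(|\alpha(u)-\alpha(v)|-1)$; $\mathrm{ola}^+(G)$ is the minimum net cost. A bridge is an edge whose removal increases the number of components; a bridge $e$ of a connected graph is $k$-separating if both components of $G-e$ have more than $k$ vertices. -}

module Defs where

open import Data.Nat using (ℕ; zero; suc; _+_; _∸_; _≤_; _<_; ∣_-_∣)
open import Data.Fin using (Fin; toℕ)
open import Data.Fin.Permutation using (Permutation′; _⟨$⟩ʳ_)
open import Data.Product using (_×_; _,_; Σ; ∃)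
open import Data.Sum using (_⊎_)
open import Data.List using (List; []; _∷_; map)
open import Data.Nat.ListAction using (sum)
open import Data.List.Relation.Unary.All using (All)
open import Data.List.Relation.Unary.Unique.Propositional using (Unique)
open import Data.List.Membership.Propositional using (_∈_)
open import Data.List.Relation.Unary.Any using (_─_)
open import Relation.Nullary using (¬_)
open import Function.Definitions using (Injective)
open import Relation.Binary.PropositionalEquality using (_≡_)

-- An edge {u,v} is stored once, as the ordered pair (u , v) with u < v.
Edge : ℕ → Set
Edge n = Fin n × Fin n

-- A finite simple graph on vertex set Fin n: a duplicate-free list of
-- edges, each stored as (u , v) with u < v (so no loops and no parallel edges).
record Graph (n : ℕ) : Set where
  constructor mkGraph
  field
    edges   : List (Edge n)
    ordered : All (λ e → toℕ (Data.Product.proj₁ e) < toℕ (Data.Product.proj₂ e)) edges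
    simple  : Unique edges
open Graph public

Adj : ∀ {n} → List (Edge n) → Fin n → Fin n → Set
Adj es u v = ((u , v) ∈ es) ⊎ ((v , u) ∈ es)

data Reach {n : ℕ} (es : List (Edge n)) : Fin n → Fin n → Set where
  here  : ∀ {u} → Reach es u u
  step  : ∀ {u v w} → Adj es u v → Reach es v w → Reach es u w

ConnectedE : ∀ {n} → List (Edge n) → Set
ConnectedE {n} es = (u v : Fin n) → Reach es u v

Connected : ∀ {n} → Graph n → Set
Connected G = ConnectedE (edges G)

_minus_ : ∀ {n} (G : Graph n) {e : Edge n} → e ∈ edges G → List (Edge n)
G minus p = edges G ─ p

-- A bridge of the connected graph G: an edge whose removal disconnects G
-- (i.e. increases the number of components from 1).
IsBridge : ∀ {n} (G : Graph n) {e : Edge n} → e ∈ edges G → Set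
IsBridge G p = ¬ ConnectedE (G minus p)

-- the component of v in the graph with edge list es has more than k vertices:
-- there are k+1 distinct vertices reachable from v
CompLarger : ∀ {n} → List (Edge n) → Fin n → ℕ → Set
CompLarger {n} es v k =
  Σ (Fin (suc k) → Fin n) λ f → Injective _≡_ _≡_ f × (∀ i → Reach es v (f i))

HasKSeparatingBridge : ∀ {n} → Graph n → ℕ → Set
HasKSeparatingBridge {n} G k =
  Σ (Fin n) λ u → Σ (Fin n) λ v → Σ ((u , v) ∈ edges G) λ p →
    IsBridge G p × CompLarger (G minus p) u k × CompLarger (G minus p) v k

-- linear arrangements: bijections Fin n → Fin n (positions shifted by one,
-- which does not change any distance)
Arrangement : ℕ → Set
Arrangement n = Permutation′ n

netCost : ∀ {n} → Graph n → Arrangement n → ℕ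
netCost G α =
  sum (map (λ e → ∣ toℕ (α ⟨$⟩ʳ Data.Product.proj₁ e) - toℕ (α ⟨$⟩ʳ Data.Product.proj₂ e) ∣ ∸ 1) (edges G))

-- ola⁺(G) ≤ k : the minimum net cost is at most k, i.e. some arrangement has
-- net cost at most k
olaPlus≤ : ∀ {n} → Graph n → ℕ → Set
olaPlus≤ {n} G k = ∃ λ (α : Arrangement n) → netCost G α ≤ k

-- Fix an arrangement of net cost at most k and call an edge long if its endpoints are at
-- distance at least 2. A long edge of net cost c crosses c + 1 ≤ 2c of the cuts between
-- consecutive positions, so there are at most 2k crossings of a cut by a long edge, and
-- one of the 2k + 1 cuts between positions j and j + 1 with k ≤ j ≤ 3k is crossed by no
-- long edge. Since G is connected, the only edge crossing that cut is the one joining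
-- positions j and j + 1; it is a bridge, and its two sides contain the vertices at
-- positions 0, …, k and j + 1, …, j + k + 1 respectively, which exist once n ≥ 4k + 2.
module Submission where

open import Defs
open import Data.Nat
  using (ℕ; zero; suc; _+_; _*_; _∸_; _≤_; _<_; _⊓_; z≤n; s≤s; s≤s⁻¹; z<s; ∣_-_∣; _≤?_; _<?_)
open import Data.Nat.Properties
open import Data.Nat.Tactic.RingSolver using (solve)
open import Data.Fin using (Fin; toℕ; fromℕ<)
open import Data.Fin.Properties using (toℕ-fromℕ<; toℕ-injective; toℕ<n)
open import Data.Fin.Permutation using (_⟨$⟩ʳ_; _⟨$⟩ˡ_; inverseˡ; inverseʳ)
open import Data.Product using (_×_; _,_; Σ; ∃; ∃₂; proj₁; proj₂)
open import Data.Sum using (_⊎_; inj₁; inj₂)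
open import Data.List using (List; []; _∷_; map)
open import Data.Nat.ListAction using (sum)
import Data.List.Relation.Unary.All as All
open import Data.List.Relation.Unary.AllPairs using (_∷_)
open import Data.List.Relation.Unary.Unique.Propositional using (Unique)
open import Data.List.Membership.Propositional using (_∈_; _∉_)
open import Data.List.Relation.Unary.Any using (here; there; _─_)
open import Function using (_∘_)
open import Function.Definitions using (Injective)
open import Relation.Nullary using (¬_; yes; no; ¬?; contradiction)
open import Relation.Nullary.Decidable using (decidable-stable)
open import Relation.Unary using (Pred; Decidable; ∁; _⊆′_)
open import Relation.Binary.PropositionalEquality
  using (_≡_; _≢_; refl; sym; trans; cong; subst; module ≡-Reasoning)
open import Level using (0ℓ)
open import Algebra.Properties.CommutativeSemigroup +-commutativeSemigroup using (interchange)

private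
  variable
    A : Set
    x y : A
    xs : List A

∈-─⁻ : (x∈xs : x ∈ xs) → y ∈ (xs ─ x∈xs) → y ∈ xs
∈-─⁻ (here _)   y∈         = there y∈
∈-─⁻ (there x∈) (here eq)  = here eq
∈-─⁻ (there x∈) (there y∈) = there (∈-─⁻ x∈ y∈)

∈-─⁺ : (x∈xs : x ∈ xs) → y ∈ xs → y ≢ x → y ∈ (xs ─ x∈xs)
∈-─⁺ (here refl) (here refl) y≢x = contradiction refl y≢x
∈-─⁺ (here _)    (there y∈)  _   = y∈
∈-─⁺ (there _)   (here eq)   _   = here eq
∈-─⁺ (there x∈)  (there y∈)  y≢x = there (∈-─⁺ x∈ y∈ y≢x)

Unique⇒∉-─ : Unique xs → (x∈xs : x ∈ xs) → x ∉ (xs ─ x∈xs)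
Unique⇒∉-─ (x≢ ∷ _) (here refl) x∈         = All.lookup x≢ x∈ refl
Unique⇒∉-─ (x≢ ∷ _) (there x∈)  (here eq)  = All.lookup x≢ x∈ (sym eq)
Unique⇒∉-─ (_ ∷ u)  (there x∈)  (there x∈′) = Unique⇒∉-─ u x∈ x∈′

module _ {n : ℕ} where

  Adj-sym : ∀ {es : List (Edge n)} {a b} → Adj es a b → Adj es b a
  Adj-sym (inj₁ ab) = inj₂ ab
  Adj-sym (inj₂ ba) = inj₁ ba

  Reach-snoc : ∀ {es : List (Edge n)} {a b c} → Reach es a b → Adj es b c → Reach es a c
  Reach-snoc here        bc = step bc here
  Reach-snoc (step ab r) bc = step ab (Reach-snoc r bc)

  Reach-sym : ∀ {es : List (Edge n)} {a b} → Reach es a b → Reach es b a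
  Reach-sym here        = here
  Reach-sym (step ab r) = Reach-snoc (Reach-sym r) (Adj-sym ab)

  leaving-edge : ∀ {es : List (Edge n)} {Q : Pred (Fin n) 0ℓ} → Decidable Q → ∀ {w z} →
                 Reach es w z → Q w → ¬ Q z → ∃₂ λ a b → Adj es a b × Q a × ¬ Q b
  leaving-edge Q? here Qw ¬Qz = contradiction Qw ¬Qz
  leaving-edge Q? (step {v = v} wv r) Qw ¬Qz with Q? v
  ... | yes Qv = leaving-edge Q? r Qv ¬Qz
  ... | no ¬Qv = _ , _ , wv , Qw , ¬Qv

  -- Truncate the walk at its first exit from Q, which happens at s.
  Reach-to-exit : ∀ {es es′ : List (Edge n)} {Q : Pred (Fin n) 0ℓ} → Decidable Q → ∀ {s} →
               (∀ {a b} → Adj es a b → Q a → Q b → Adj es′ a b) →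
               (∀ {a b} → Adj es a b → Q a → ¬ Q b → a ≡ s) →
               ∀ {w z} → Reach es w z → Q w → ¬ Q z → Reach es′ w s
  Reach-to-exit Q? inside exit here Qw ¬Qz = contradiction Qw ¬Qz
  Reach-to-exit Q? inside exit (step {v = v} wv r) Qw ¬Qz with Q? v
  ... | yes Qv = step (inside wv Qw Qv) (Reach-to-exit Q? inside exit r Qv ¬Qz)
  ... | no ¬Qv = subst (λ a → Reach _ a _) (sym (exit wv Qw ¬Qv)) here

module _ {n : ℕ} (G : Graph n) {u v : Fin n} (uv∈G : (u , v) ∈ edges G) where

  Adj-minus⁻ : ∀ {a b} → Adj (G minus uv∈G) a b → Adj (edges G) a b
  Adj-minus⁻ (inj₁ ab) = inj₁ (∈-─⁻ uv∈G ab)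
  Adj-minus⁻ (inj₂ ba) = inj₂ (∈-─⁻ uv∈G ba)

  Adj-minus⁺ : ∀ {P : Pred (Fin n) 0ℓ} → ¬ (P u × P v) →
               ∀ {a b} → Adj (edges G) a b → P a → P b → Adj (G minus uv∈G) a b
  Adj-minus⁺ ¬PuPv (inj₁ ab) Pa Pb = inj₁ (∈-─⁺ uv∈G ab λ { refl → ¬PuPv (Pa , Pb) })
  Adj-minus⁺ ¬PuPv (inj₂ ba) Pa Pb = inj₂ (∈-─⁺ uv∈G ba λ { refl → ¬PuPv (Pb , Pa) })

  ¬Adj-minus : ¬ Adj (G minus uv∈G) u v
  ¬Adj-minus (inj₁ uv∈G-uv) = Unique⇒∉-─ (simple G) uv∈G uv∈G-uv
  ¬Adj-minus (inj₂ vu∈G-uv) =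
    <-asym (All.lookup (ordered G) uv∈G) (All.lookup (ordered G) (∈-─⁻ uv∈G vu∈G-uv))

-- CompLarger es v k is MoreThan k (Reach es v).
MoreThan : ∀ {n} → ℕ → Pred (Fin n) 0ℓ → Set
MoreThan {n} k P = Σ (Fin (suc k) → Fin n) λ f → Injective _≡_ _≡_ f × (∀ i → P (f i))

MoreThan-mono : ∀ {n k} {P R : Pred (Fin n) 0ℓ} → P ⊆′ R → MoreThan k P → MoreThan k R
MoreThan-mono P⊆R (f , f-inj , Pf) = f , f-inj , λ i → P⊆R (f i) (Pf i)

module _ {n : ℕ} (G : Graph n) (conn : Connected G)
         {Q : Pred (Fin n) 0ℓ} (Q? : Decidable Q) {x y : Fin n} (Qx : Q x) (¬Qy : ¬ Q y)
         (crossing⇒xy : ∀ {a b} → Adj (edges G) a b → Q a → ¬ Q b → a ≡ x × b ≡ y) where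

  private
    x-adj-y : Adj (edges G) x y
    x-adj-y with leaving-edge Q? (conn x y) Qx ¬Qy
    ... | a , b , ab , Qa , ¬Qb with crossing⇒xy ab Qa ¬Qb
    ... | refl , refl = ab

    module Removed {u v} (uv∈G : (u , v) ∈ edges G)
                   (¬QuQv : ¬ (Q u × Q v)) (¬∁Qu∁Qv : ¬ (∁ Q u × ∁ Q v))
                   (¬Adj-xy : ¬ Adj (G minus uv∈G) x y) where
      G-uv : List (Edge n)
      G-uv = G minus uv∈G

      bridge : IsBridge G uv∈G
      bridge conn′ with leaving-edge Q? (conn′ x y) Qx ¬Qy
      ... | a , b , ab , Qa , ¬Qb with crossing⇒xy (Adj-minus⁻ G uv∈G ab) Qa ¬Qb
      ... | refl , refl = ¬Adj-xy ab

      reach-x : Q ⊆′ Reach G-uv x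
      reach-x w Qw = Reach-sym (Reach-to-exit Q? (Adj-minus⁺ G uv∈G ¬QuQv)
                                   (λ ab Qa ¬Qb → proj₁ (crossing⇒xy ab Qa ¬Qb)) (conn w y) Qw ¬Qy)

      reach-y : ∁ Q ⊆′ Reach G-uv y
      reach-y w ¬Qw = Reach-sym (Reach-to-exit (¬? ∘ Q?) (Adj-minus⁺ G uv∈G ¬∁Qu∁Qv)
                                     exit (conn w x) ¬Qw (λ ¬Qx → ¬Qx Qx))
        where
        exit : ∀ {a b} → Adj (edges G) a b → ¬ Q a → ¬ ¬ Q b → a ≡ y
        exit ab ¬Qa ¬¬Qb = proj₂ (crossing⇒xy (Adj-sym ab) (decidable-stable (Q? _) ¬¬Qb) ¬Qa)

  uniqueCrossing⇒separatingBridge : ∀ {k} → MoreThan k Q → MoreThan k (∁ Q) → HasKSeparatingBridge G k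
  uniqueCrossing⇒separatingBridge Q>k ∁Q>k with x-adj-y
  ... | inj₁ xy∈G = x , y , xy∈G , bridge , MoreThan-mono reach-x Q>k , MoreThan-mono reach-y ∁Q>k
    where open Removed xy∈G (¬Qy ∘ proj₂) (λ (¬Qx , _) → ¬Qx Qx) (¬Adj-minus G xy∈G)
  ... | inj₂ yx∈G = y , x , yx∈G , bridge , MoreThan-mono reach-y ∁Q>k , MoreThan-mono reach-x Q>k
    where open Removed yx∈G (¬Qy ∘ proj₁) (λ (_ , ¬Qx) → ¬Qx Qx) (¬Adj-minus G yx∈G ∘ Adj-sym)

∑< : ℕ → (ℕ → ℕ) → ℕ
∑< zero    f = 0
∑< (suc N) f = f N + ∑< N f

syntax ∑< N (λ j → e) = ∑[ j < N ] e

∑<-distrib-+ : ∀ N (f g : ℕ → ℕ) → ∑[ j < N ] (f j + g j) ≡ ∑< N f + ∑< N g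
∑<-distrib-+ zero    f g = refl
∑<-distrib-+ (suc N) f g = begin
  (f N + g N) + ∑[ j < N ] (f j + g j) ≡⟨ cong (f N + g N +_) (∑<-distrib-+ N f g) ⟩
  (f N + g N) + (∑< N f + ∑< N g)      ≡⟨ interchange (f N) (g N) (∑< N f) (∑< N g) ⟩
  (f N + ∑< N f) + (g N + ∑< N g)      ∎
  where open ≡-Reasoning

∑<-zero : ∀ N → ∑[ j < N ] 0 ≡ 0
∑<-zero zero    = refl
∑<-zero (suc N) = ∑<-zero N

∑<-pigeonhole : ∀ m l (f : ℕ → ℕ) → ∑< (m + l) f < l → ∃ λ i → m ≤ i × i < m + l × f i ≡ 0
∑<-pigeonhole m zero    f ()
∑<-pigeonhole m (suc l) f small rewrite +-suc m l with f (m + l) in eq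
... | zero  = m + l , m≤m+n m l , ≤-refl , eq
... | suc c with ∑<-pigeonhole m l f (<-≤-trans (m<n+m _ z<s) (s≤s⁻¹ small))
... | i , m≤i , i<m+l , fi≡0 = i , m≤i , m<n⇒m<1+n i<m+l , fi≡0

[_≤_<_] : ℕ → ℕ → ℕ → ℕ
[ s ≤ j < t ] with s ≤? j | j <? t
... | yes _ | yes _ = 1
... | _     | _     = 0

∑<-[≤<]≤ : ∀ s t N → ∑[ j < N ] [ s ≤ j < t ] ≤ (N ⊓ t) ∸ s
∑<-[≤<]≤ s t zero    = z≤n
∑<-[≤<]≤ s t (suc N) with s ≤? N | N <? t
... | yes s≤N | yes N<t = begin
  1 + ∑[ j < N ] [ s ≤ j < t ] ≤⟨ s≤s (∑<-[≤<]≤ s t N) ⟩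
  1 + ((N ⊓ t) ∸ s)            ≡⟨ cong (λ m → 1 + (m ∸ s)) (m≤n⇒m⊓n≡m (<⇒≤ N<t)) ⟩
  1 + (N ∸ s)                  ≡⟨ +-∸-assoc 1 s≤N ⟨
  suc N ∸ s                    ≡⟨ cong (_∸ s) (m≤n⇒m⊓n≡m N<t) ⟨
  (suc N ⊓ t) ∸ s              ∎
  where open ≤-Reasoning
... | yes _ | no _ = ≤-trans (∑<-[≤<]≤ s t N) (∸-monoˡ-≤ s (⊓-monoˡ-≤ t (n≤1+n N)))
... | no _  | _    = ≤-trans (∑<-[≤<]≤ s t N) (∸-monoˡ-≤ s (⊓-monoˡ-≤ t (n≤1+n N)))

[n∸m]+[m∸n]≡∣m-n∣ : ∀ m n → (n ∸ m) + (m ∸ n) ≡ ∣ m - n ∣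
[n∸m]+[m∸n]≡∣m-n∣ zero    zero    = refl
[n∸m]+[m∸n]≡∣m-n∣ zero    (suc n) = +-identityʳ (suc n)
[n∸m]+[m∸n]≡∣m-n∣ (suc m) zero    = refl
[n∸m]+[m∸n]≡∣m-n∣ (suc m) (suc n) = [n∸m]+[m∸n]≡∣m-n∣ m n

-- Cut j lies between positions j and j + 1.
crossing : ℕ → ℕ → ℕ → ℕ
crossing s t j = [ s ≤ j < t ] + [ t ≤ j < s ]

∑<-crossing≤ : ∀ s t N → ∑[ j < N ] crossing s t j ≤ ∣ s - t ∣
∑<-crossing≤ s t N = begin
  ∑[ j < N ] crossing s t j                            ≡⟨ ∑<-distrib-+ N _ _ ⟩
  ∑[ j < N ] [ s ≤ j < t ] + ∑[ j < N ] [ t ≤ j < s ] ≤⟨ +-mono-≤ (below s t) (below t s) ⟩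
  (t ∸ s) + (s ∸ t)                                    ≡⟨ [n∸m]+[m∸n]≡∣m-n∣ s t ⟩
  ∣ s - t ∣                                            ∎
  where
  open ≤-Reasoning
  below : ∀ s t → ∑[ j < N ] [ s ≤ j < t ] ≤ t ∸ s
  below s t = ≤-trans (∑<-[≤<]≤ s t N) (∸-monoˡ-≤ s (m⊓n≤n N t))

longCrossing : ℕ → ℕ → ℕ → ℕ
longCrossing s t j with 2 ≤? ∣ s - t ∣
... | yes _ = crossing s t j
... | no  _ = 0

m≤2*[m∸1] : ∀ {m} → 2 ≤ m → m ≤ 2 * (m ∸ 1)
m≤2*[m∸1] {suc zero}    (s≤s ())
m≤2*[m∸1] {suc (suc m)} _ = s≤s (≤-trans (s≤s (m≤m+n m (m + 0))) (≤-reflexive (sym (+-suc m (m + 0)))))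

∑<-longCrossing≤ : ∀ s t N → ∑[ j < N ] longCrossing s t j ≤ 2 * (∣ s - t ∣ ∸ 1)
∑<-longCrossing≤ s t N with 2 ≤? ∣ s - t ∣
... | yes long  = ≤-trans (∑<-crossing≤ s t N) (m≤2*[m∸1] long)
... | no  short = ≤-trans (≤-reflexive (∑<-zero N)) z≤n

longCrossing-comm : ∀ s t j → longCrossing s t j ≡ longCrossing t s j
longCrossing-comm s t j with 2 ≤? ∣ s - t ∣ | 2 ≤? ∣ t - s ∣
... | yes _    | yes _    = +-comm [ s ≤ j < t ] [ t ≤ j < s ]
... | no  _    | no  _    = refl
... | yes long | no short = contradiction (subst (2 ≤_) (∣-∣-comm s t) long) short
... | no short | yes long = contradiction (subst (2 ≤_) (∣-∣-comm t s) long) short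

longCrossing≡0 : ∀ {s t j} → longCrossing s t j ≡ 0 → s ≤ j → j < t → s ≡ j × t ≡ suc j
longCrossing≡0 {s} {t} {j} none s≤j j<t with 2 ≤? ∣ s - t ∣
... | yes _ with s ≤? j | j <? t
...   | yes _  | yes _  = contradiction none λ ()
...   | no s≰j | _      = contradiction s≤j s≰j
...   | yes _  | no j≮t = contradiction j<t j≮t
longCrossing≡0 {s} {t} {j} _ s≤j j<t | no short =
  ≤-antisym s≤j (s≤s⁻¹ (≤-trans j<t t≤1+s)) , ≤-antisym (≤-trans t≤1+s (s≤s s≤j)) j<t
  where
  t≤1+s : t ≤ suc s
  t≤1+s = begin
    t             ≤⟨ m≤n+m∸n t s ⟩
    s + (t ∸ s)   ≤⟨ +-monoʳ-≤ s (s≤s⁻¹ (≤-<-trans (m∸n≤∣m-n∣ t s) (subst (_< 2) (∣-∣-comm s t) (≰⇒> short)))) ⟩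
    s + 1         ≡⟨ +-comm s 1 ⟩
    suc s         ∎
    where open ≤-Reasoning

sum-map≡0 : ∀ {A : Set} (f : A → ℕ) {x xs} → sum (map f xs) ≡ 0 → x ∈ xs → f x ≡ 0
sum-map≡0 f {xs = y ∷ _} none (here refl) = m+n≡0⇒m≡0 (f y) none
sum-map≡0 f {xs = y ∷ _} none (there x∈)  = sum-map≡0 f (m+n≡0⇒n≡0 (f y) none) x∈

module _ {n : ℕ} (α : Arrangement n) where

  pos : Fin n → ℕ
  pos w = toℕ (α ⟨$⟩ʳ w)

  pos-injective : Injective _≡_ _≡_ pos
  pos-injective {v} {w} eq = begin
    v                            ≡⟨ inverseˡ α ⟨
    α ⟨$⟩ˡ (α ⟨$⟩ʳ v)            ≡⟨ cong (α ⟨$⟩ˡ_) (toℕ-injective eq) ⟩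
    α ⟨$⟩ˡ (α ⟨$⟩ʳ w)            ≡⟨ inverseˡ α ⟩
    w                            ∎
    where open ≡-Reasoning

  at : (m : ℕ) → m < n → Fin n
  at m m<n = α ⟨$⟩ˡ fromℕ< m<n

  pos-at : ∀ {m} (m<n : m < n) → pos (at m m<n) ≡ m
  pos-at m<n = trans (cong toℕ (inverseʳ α)) (toℕ-fromℕ< m<n)

  MoreThan-positions : ∀ k lo {P : Pred (Fin n) 0ℓ} → lo + k < n →
                       (∀ w → lo ≤ pos w → pos w ≤ lo + k → P w) → MoreThan k P
  MoreThan-positions k lo {P} lo+k<n P-interval = f , f-injective , P-f
    where
    lo+i<n : (i : Fin (suc k)) → lo + toℕ i < n
    lo+i<n i = ≤-<-trans (+-monoʳ-≤ lo (s≤s⁻¹ (toℕ<n i))) lo+k<n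
    f : Fin (suc k) → Fin n
    f i = at (lo + toℕ i) (lo+i<n i)
    f-injective : Injective _≡_ _≡_ f
    f-injective {i} {i′} eq = toℕ-injective (+-cancelˡ-≡ lo _ _ (begin
      lo + toℕ i    ≡⟨ pos-at (lo+i<n i) ⟨
      pos (f i)     ≡⟨ cong pos eq ⟩
      pos (f i′)    ≡⟨ pos-at (lo+i<n i′) ⟩
      lo + toℕ i′   ∎))
      where open ≡-Reasoning
    P-f : ∀ i → P (f i)
    P-f i = P-interval (f i) (subst (lo ≤_) (sym pos-fi) (m≤m+n lo (toℕ i)))
                             (subst (_≤ lo + k) (sym pos-fi) (+-monoʳ-≤ lo (s≤s⁻¹ (toℕ<n i))))
      where
      pos-fi : pos (f i) ≡ lo + toℕ i
      pos-fi = pos-at (lo+i<n i)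

  edgeCost : Edge n → ℕ
  edgeCost e = ∣ pos (proj₁ e) - pos (proj₂ e) ∣ ∸ 1

  longCrossingsAt : List (Edge n) → ℕ → ℕ
  longCrossingsAt es j = sum (map (λ e → longCrossing (pos (proj₁ e)) (pos (proj₂ e)) j) es)

  ∑<-longCrossingsAt≤ : ∀ N es → ∑[ j < N ] longCrossingsAt es j ≤ 2 * sum (map edgeCost es)
  ∑<-longCrossingsAt≤ N []       = ≤-reflexive (∑<-zero N)
  ∑<-longCrossingsAt≤ N (e ∷ es) = begin
    ∑[ j < N ] (longCrossing s t j + longCrossingsAt es j)        ≡⟨ ∑<-distrib-+ N _ _ ⟩
    ∑[ j < N ] longCrossing s t j + ∑[ j < N ] longCrossingsAt es j ≤⟨ +-mono-≤ (∑<-longCrossing≤ s t N) (∑<-longCrossingsAt≤ N es) ⟩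
    2 * edgeCost e + 2 * sum (map edgeCost es)                    ≡⟨ *-distribˡ-+ 2 (edgeCost e) _ ⟨
    2 * sum (map edgeCost (e ∷ es))                               ∎
    where
    open ≤-Reasoning
    s = pos (proj₁ e)
    t = pos (proj₂ e)

  cleanCut : ∀ {k} (G : Graph n) → netCost G α ≤ k →
             ∃ λ j → k ≤ j × j < k + suc (2 * k) × longCrossingsAt (edges G) j ≡ 0
  cleanCut {k} G cost≤k = ∑<-pigeonhole k (suc (2 * k)) (longCrossingsAt (edges G))
    (s≤s (≤-trans (∑<-longCrossingsAt≤ (k + suc (2 * k)) (edges G)) (*-monoʳ-≤ 2 cost≤k)))

  cleanCut⇒separatingBridge : ∀ {k j} (G : Graph n) → Connected G → longCrossingsAt (edges G) j ≡ 0 →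
                              k ≤ j → suc j + k < n → HasKSeparatingBridge G k
  cleanCut⇒separatingBridge {k} {j} G conn clean k≤j 1+j+k<n =
    uniqueCrossing⇒separatingBridge G conn (λ w → pos w ≤? j) (≤-reflexive (pos-at j<n)) ¬Qy
      crossing⇒xy left right
    where
    1+j<n : suc j < n
    1+j<n = ≤-<-trans (m≤m+n (suc j) k) 1+j+k<n
    j<n : j < n
    j<n = <-trans (n<1+n j) 1+j<n
    ¬Qy : ¬ pos (at (suc j) 1+j<n) ≤ j
    ¬Qy = <⇒≱ (≤-reflexive (sym (pos-at 1+j<n)))

    crossing⇒xy : ∀ {a b} → Adj (edges G) a b → pos a ≤ j → ¬ pos b ≤ j →
                  a ≡ at j j<n × b ≡ at (suc j) 1+j<n
    crossing⇒xy ab pa≤j pb≰j =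
      let pa≡j , pb≡1+j = positions ab pa≤j (≰⇒> pb≰j)
      in pos-injective (trans pa≡j (sym (pos-at j<n))) , pos-injective (trans pb≡1+j (sym (pos-at 1+j<n)))
      where
      positions : ∀ {a b} → Adj (edges G) a b → pos a ≤ j → j < pos b → pos a ≡ j × pos b ≡ suc j
      positions (inj₁ ab∈G) = longCrossing≡0 (sum-map≡0 _ clean ab∈G)
      positions {a} {b} (inj₂ ba∈G) =
        longCrossing≡0 (trans (longCrossing-comm (pos a) (pos b) j) (sum-map≡0 _ clean ba∈G))

    left : MoreThan k (λ w → pos w ≤ j)
    left = MoreThan-positions k 0 (≤-<-trans k≤j j<n) (λ _ _ pw≤k → ≤-trans pw≤k k≤j)
    right : MoreThan k (∁ (λ w → pos w ≤ j))
    right = MoreThan-positions k (suc j) 1+j+k<n (λ _ 1+j≤pw _ → <⇒≱ 1+j≤pw)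

lemma2p7 : (k : ℕ) → 1 ≤ k → (n : ℕ) → (G : Graph n) → Connected G → olaPlus≤ G k →
    HasKSeparatingBridge G k ⊎ n ≤ 4 * k + 1
lemma2p7 k _ n G conn (α , cost≤k) with n ≤? 4 * k + 1
... | yes n≤4k+1 = inj₂ n≤4k+1
... | no  n≰4k+1 with cleanCut α G cost≤k
... | j , k≤j , j<3k+1 , clean = inj₁ (cleanCut⇒separatingBridge α G conn clean k≤j 1+j+k<n)
  where
  1+j+k<n : suc j + k < n
  1+j+k<n = begin-strict
    suc j + k            ≤⟨ +-monoˡ-≤ k j<3k+1 ⟩
    k + suc (2 * k) + k  ≡⟨ solve (k ∷ []) ⟩
    4 * k + 1            <⟨ ≰⇒> n≰4k+1 ⟩
    n                    ∎
    where open ≤-Reasoning
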